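{- For $n\in\{3,4,5\}$, the prism $Y_n=C_n\square P_2$ satisfies $IDI(Y_n)\neq 2$.
   Context: $C_n$ is the cycle on $n$ vertices, $P_2$ the path on two vertices, and $\square$ the Cartesian product. For a connected graph $G=(V,E)$ of diameter $d$ and $f:V\to\mathbb{R}$, the string of $v$ under $f$ is the $d$-vector whose $i$-th coordinate is $\sum_{w:\ d(v,w)=i} f(w)$ ($d(\cdot,\cdot)$ = graph distance). $IDI(G)$ is the minimum $k$ such that some $f$ with $|f(V)|=k$ gives all vertices pairwise distinct strings.
   Formalization: The functions f defining the strings and IDI take values in ℚ rather than ℝ. -}

module Defs where

open import Data.Nat using (ℕ; zero; suc; _∸_; _<_; _≡ᵇ_; _⊔_)
open import Data.Bool using (Bool; true; false; _∨_; _∧_; if_then_else_; not)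
open import Data.Fin using (Fin; toℕ)
open import Data.Fin.Properties using () renaming (_≟_ to _≟F_)
open import Data.List using (List; map; foldr; length; deduplicate; allFin; filter)
open import Data.Vec using (Vec; tabulate)
open import Data.Rational using (ℚ; 0ℚ; _+_)
open import Data.Rational.Properties using () renaming (_≟_ to _≟Q_)
open import Relation.Nullary.Decidable using (⌊_⌋)
open import Relation.Binary.PropositionalEquality using (_≡_; _≢_)
open import Data.Product using (Σ; _×_)

record Graph : Set where
  field
    N   : ℕ
    adj : Fin N → Fin N → Bool
open Graph public

anyFin : ∀ {N} → (Fin N → Bool) → Bool
anyFin {N} p = foldr (λ u b → p u ∨ b) false (allFin N)

within : (G : Graph) → ℕ → Fin (N G) → Fin (N G) → Bool
within G zero    v w = ⌊ v ≟F w ⌋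
within G (suc k) v w = within G k v w ∨ anyFin (λ u → within G k v u ∧ adj G u w)

distSearch : (G : Graph) → ℕ → ℕ → Fin (N G) → Fin (N G) → ℕ
distSearch G k zero    v w = k
distSearch G k (suc fuel) v w =
  if within G k v w then k else distSearch G (suc k) fuel v w

-- Graph distance d(v,w): least k with a walk of length k (k ≤ N; any
-- shortest path has length < N, so this is exact for connected graphs).
dist : (G : Graph) → Fin (N G) → Fin (N G) → ℕ
dist G v w = distSearch G 0 (N G) v w

diam : Graph → ℕ
diam G = foldr (λ v m → foldr (λ w m' → dist G v w ⊔ m') m (allFin (N G))) 0 (allFin (N G))

Connected : Graph → Set
Connected G = ∀ v w → within G (N G) v w ≡ true

sphereSum : (G : Graph) → (Fin (N G) → ℚ) → Fin (N G) → ℕ → ℚ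
sphereSum G f v i =
  foldr (λ w s → (if dist G v w ≡ᵇ i then f w else 0ℚ) + s) 0ℚ (allFin (N G))

string : (G : Graph) → (Fin (N G) → ℚ) → Fin (N G) → Vec ℚ (diam G)
string G f v = tabulate (λ i → sphereSum G f v (suc (toℕ i)))

imageSize : (G : Graph) → (Fin (N G) → ℚ) → ℕ
imageSize G f = length (deduplicate _≟Q_ (map f (allFin (N G))))

Distinguishing : (G : Graph) → (Fin (N G) → ℚ) → Set
Distinguishing G f = ∀ v w → v ≢ w → string G f v ≢ string G f w

IsIDI : Graph → ℕ → Set
IsIDI G k = Σ (Fin (N G) → ℚ) (λ f → Distinguishing G f × imageSize G f ≡ k)
          × (∀ f → Distinguishing G f → k Data.Nat.≤ imageSize G f)

-- Prism Y_n = C_n □ P_2 on vertices Fin (n + n):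
-- index i < n is (position i, layer 0); index n + p is (position p, layer 1).
layer : ℕ → ℕ → ℕ
layer n i = if Data.Nat._<ᵇ_ i n then 0 else 1

pos : ℕ → ℕ → ℕ
pos n i = if Data.Nat._<ᵇ_ i n then i else i ∸ n

cycAdj : ℕ → ℕ → ℕ → Bool
cycAdj n p q = (q ≡ᵇ suc p) ∨ (p ≡ᵇ suc q)
             ∨ (p ≡ᵇ (n ∸ 1)) ∧ (q ≡ᵇ 0) ∨ (q ≡ᵇ (n ∸ 1)) ∧ (p ≡ᵇ 0)

prismAdj : ℕ → ℕ → ℕ → Bool
prismAdj n i j =
  ((layer n i ≡ᵇ layer n j) ∧ cycAdj n (pos n i) (pos n j))
  ∨ ((pos n i ≡ᵇ pos n j) ∧ not (layer n i ≡ᵇ layer n j))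

prism : ℕ → Graph
prism n = record { N = n Data.Nat.+ n ; adj = λ u v → prismAdj n (toℕ u) (toℕ v) }

{-# OPTIONS --safe #-}
-- If f takes exactly two values c₁ and c₂, let S be the set where f = c₂.
-- The coordinate of the string of v at radius i is then
-- c₁ · |sphere(v,i) ∖ S| + c₂ · |sphere(v,i) ∩ S|, so two distinct vertices
-- whose spheres of every radius 1 … diam meet S and its complement equally
-- often ("twins" for S) get the same string. For n = 3, 4, 5 every one of the
-- 2²ⁿ subsets S of the vertices of Yₙ has a pair of twins, which is checked
-- by enumeration once the graph distance is replaced by its closed form
-- (cyclic distance of the positions, plus 1 if the layers differ).
module Submission where

open import Defs
open import Data.Nat using (ℕ; _≤_; suc; _≡ᵇ_; _⊓_; _∸_; ∣_-_∣; s≤s)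
import Data.Nat as ℕ
open import Data.Bool using (Bool; true; false; _∧_; not; if_then_else_; T)
open import Data.Fin using (Fin; toℕ)
open import Data.Fin.Properties using (any?; all?) renaming (_≟_ to _≟ᶠ_)
open import Data.Fin.Subset using (Subset)
open import Data.Fin.Subset.Properties using (anySubset?)
open import Data.List using (List; []; _∷_; length; filterᵇ; deduplicate; allFin; foldr)
open import Data.List.Properties using (filter-≐)
open import Data.List.Relation.Unary.Any using (here; there)
open import Data.List.Membership.Propositional using (_∈_)
open import Data.List.Membership.Propositional.Properties using (∈-deduplicate⁺; ∈-map⁺; ∈-allFin)
open import Data.Vec using (lookup; tabulate)
open import Data.Vec.Properties using (lookup∘tabulate; tabulate-cong)
open import Data.Rational using (ℚ; 0ℚ; _+_)
open import Data.Rational.Base using (+-0-rawMonoid)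
open import Data.Rational.Properties using (+-assoc; +-identityˡ; +-0-commutativeMonoid) renaming (_≟_ to _≟ℚ_)
open import Algebra.Bundles using (CommutativeMonoid)
open import Algebra.Properties.CommutativeSemigroup (CommutativeMonoid.commutativeSemigroup +-0-commutativeMonoid)
  using (x∙yz≈y∙xz)
open import Algebra.Definitions.RawMonoid +-0-rawMonoid using () renaming (_×_ to _·_)
open import Data.Product using (∃₂; _×_; _,_; proj₁; proj₂)
open import Data.Sum using (_⊎_; inj₁; inj₂)
open import Function using (_∘_; case_of_)
open import Relation.Nullary using (Dec; yes; no; ¬?; map′; contradiction)
open import Relation.Nullary.Decidable using (⌊_⌋; _×-dec_; decidable-stable; from-yes)
open import Relation.Binary.Definitions using (DecidableEquality)
open import Relation.Binary.PropositionalEquality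
  using (_≡_; _≢_; refl; sym; trans; cong; cong₂; subst; module ≡-Reasoning)

deduplicate-length≡2⇒two-values : ∀ {a} {A : Set a} (_≟_ : DecidableEquality A) {xs : List A} →
  length (deduplicate _≟_ xs) ≡ 2 → ∃₂ λ c₁ c₂ → ∀ {x} → x ∈ xs → x ≡ c₁ ⊎ x ≡ c₂
deduplicate-length≡2⇒two-values _≟_ {xs} _ with deduplicate _≟_ xs in dedup
... | c₁ ∷ c₂ ∷ [] = c₁ , c₂ , λ x∈xs →
  case subst (_ ∈_) dedup (∈-deduplicate⁺ _≟_ x∈xs) of λ where
    (here x≡c₁)         → inj₁ x≡c₁
    (there (here x≡c₂)) → inj₂ x≡c₂

count : ∀ {a} {A : Set a} → (A → Bool) → List A → ℕ
count p = length ∘ filterᵇ p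

count-cong : ∀ {a} {A : Set a} {p q : A → Bool} → (∀ x → p x ≡ q x) → ∀ xs → count p xs ≡ count q xs
count-cong p≗q xs = cong length (filter-≐ _ _ ((λ {x} → subst T (p≗q x)) , (λ {x} → subst T (sym (p≗q x)))) xs)

module _ {a} {A : Set a} {f : A → ℚ} {c₁ c₂ : ℚ} (S : A → Bool)
         (f-by-S : ∀ x → f x ≡ (if S x then c₂ else c₁)) where

  foldr-if-two-valued : ∀ (p : A → Bool) xs →
    foldr (λ w s → (if p w then f w else 0ℚ) + s) 0ℚ xs
      ≡ count (λ w → p w ∧ not (S w)) xs · c₁ + count (λ w → p w ∧ S w) xs · c₂
  foldr-if-two-valued p [] = refl
  foldr-if-two-valued p (x ∷ xs) with p x | S x in Sx | foldr-if-two-valued p xs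
  ... | false | _     | ih = trans (+-identityˡ _) ih
  ... | true  | false | ih rewrite f-by-S x | Sx | ih = sym (+-assoc c₁ _ _)
  ... | true  | true  | ih rewrite f-by-S x | Sx | ih =
    x∙yz≈y∙xz c₂ (count (λ w → p w ∧ not (S w)) xs · c₁) (count (λ w → p w ∧ S w) xs · c₂)

two-valued⇒by-indicator : ∀ {a} {A : Set a} (f : A → ℚ) {c₁ c₂} → (∀ x → f x ≡ c₁ ⊎ f x ≡ c₂) →
  ∀ x → f x ≡ (if ⌊ f x ≟ℚ c₂ ⌋ then c₂ else c₁)
two-valued⇒by-indicator f {c₁} {c₂} two-valued x with f x ≟ℚ c₂ | two-valued x
... | yes fx≡c₂ | _          = fx≡c₂
... | no  _     | inj₁ fx≡c₁ = fx≡c₁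
... | no  fx≢c₂ | inj₂ fx≡c₂ = contradiction fx≡c₂ fx≢c₂

allSubsets? : ∀ {n p} {P : Subset n → Set p} → (∀ S → Dec (P S)) → Dec (∀ S → P S)
allSubsets? P? = map′ (λ ¬∃¬P S → decidable-stable (P? S) (λ ¬PS → ¬∃¬P (S , ¬PS)))
                      (λ ∀P (S , ¬PS) → ¬PS (∀P S))
                      (¬? (anySubset? (¬? ∘ P?)))

module _ (G : Graph) (D : Fin (N G) → Fin (N G) → ℕ) where

  sphereCount : (Fin (N G) → Bool) → Fin (N G) → ℕ → ℕ
  sphereCount S v i = count (λ w → (D v w ≡ᵇ i) ∧ S w) (allFin (N G))

  Twins : ℕ → (Fin (N G) → Bool) → Fin (N G) → Fin (N G) → Set
  Twins d S v w = ∀ (i : Fin d) →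
    sphereCount S v (suc (toℕ i)) ≡ sphereCount S w (suc (toℕ i)) ×
    sphereCount (not ∘ S) v (suc (toℕ i)) ≡ sphereCount (not ∘ S) w (suc (toℕ i))

  HasTwins : ℕ → (Fin (N G) → Bool) → Set
  HasTwins d S = ∃₂ λ v w → v ≢ w × Twins d S v w

  hasTwins? : ∀ d S → Dec (HasTwins d S)
  hasTwins? d S = any? λ v → any? λ w → ¬? (v ≟ᶠ w) ×-dec all? λ i → (_ ℕ.≟ _) ×-dec (_ ℕ.≟ _)

module _ (G : Graph) {D : Fin (N G) → Fin (N G) → ℕ} (dist≗D : ∀ v w → dist G v w ≡ D v w)
         {f : Fin (N G) → ℚ} {c₁ c₂ : ℚ} (S : Fin (N G) → Bool)
         (f-by-S : ∀ x → f x ≡ (if S x then c₂ else c₁)) where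

  sphereSum-two-valued : ∀ v i →
    sphereSum G f v i ≡ sphereCount G D (not ∘ S) v i · c₁ + sphereCount G D S v i · c₂
  sphereSum-two-valued v i = trans
    (foldr-if-two-valued S f-by-S (λ w → dist G v w ≡ᵇ i) (allFin (N G)))
    (cong₂ (λ a b → a · c₁ + b · c₂) (sphereCount-dist (not ∘ S)) (sphereCount-dist S))
    where
    sphereCount-dist : ∀ T → count (λ w → (dist G v w ≡ᵇ i) ∧ T w) (allFin (N G)) ≡ sphereCount G D T v i
    sphereCount-dist T = count-cong (λ w → cong (λ d → (d ≡ᵇ i) ∧ T w) (dist≗D v w)) (allFin (N G))

  twins⇒string≡ : ∀ {v w} → Twins G D (diam G) S v w → string G f v ≡ string G f w
  twins⇒string≡ {v} {w} twins = tabulate-cong λ i → begin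
    sphereSum G f v (suc (toℕ i))
      ≡⟨ sphereSum-two-valued v (suc (toℕ i)) ⟩
    sphereCount G D (not ∘ S) v (suc (toℕ i)) · c₁ + sphereCount G D S v (suc (toℕ i)) · c₂
      ≡⟨ cong₂ (λ a b → a · c₁ + b · c₂) (proj₂ (twins i)) (proj₁ (twins i)) ⟩
    sphereCount G D (not ∘ S) w (suc (toℕ i)) · c₁ + sphereCount G D S w (suc (toℕ i)) · c₂
      ≡⟨ sphereSum-two-valued w (suc (toℕ i)) ⟨
    sphereSum G f w (suc (toℕ i)) ∎
    where open ≡-Reasoning

allHaveTwins⇒imageSize≢2 : ∀ G {D d} → (∀ v w → dist G v w ≡ D v w) → diam G ≡ d →
  (∀ (S : Subset (N G)) → HasTwins G D d (lookup S)) →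
  ∀ f → Distinguishing G f → imageSize G f ≢ 2
allHaveTwins⇒imageSize≢2 G dist≗D refl allHaveTwins f distinguishing size≡2 =
  let c₁ , c₂ , two-valued = deduplicate-length≡2⇒two-values _≟ℚ_ size≡2
      χ = λ x → ⌊ f x ≟ℚ c₂ ⌋
      f-by-S x = trans (two-valued⇒by-indicator f (λ y → two-valued (∈-map⁺ f (∈-allFin y))) x)
                       (cong (if_then c₂ else c₁) (sym (lookup∘tabulate χ x)))
      v , w , v≢w , twins = allHaveTwins (tabulate χ)
  in distinguishing v w v≢w (twins⇒string≡ G dist≗D (lookup (tabulate χ)) f-by-S twins)

-- dist is an exponential walk search, far too slow to evaluate inside the
-- enumeration; hence this closed form, and the diameter passed as a literal d.
cycleDist : ℕ → ℕ → ℕ → ℕ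
cycleDist n p q = ∣ p - q ∣ ⊓ (n ∸ ∣ p - q ∣)

prismDist : (n : ℕ) → Fin (n ℕ.+ n) → Fin (n ℕ.+ n) → ℕ
prismDist n v w = cycleDist n (pos n (toℕ v)) (pos n (toℕ w))
                  ℕ.+ (if layer n (toℕ v) ≡ᵇ layer n (toℕ w) then 0 else 1)

dist≗prismDist? : ∀ n → Dec (∀ v w → dist (prism n) v w ≡ prismDist n v w)
dist≗prismDist? n = all? λ v → all? λ w → dist (prism n) v w ℕ.≟ prismDist n v w

allHaveTwins? : ∀ n d → Dec (∀ (S : Subset (n ℕ.+ n)) → HasTwins (prism n) (prismDist n) d (lookup S))
allHaveTwins? n d = allSubsets? (hasTwins? (prism n) (prismDist n) d ∘ lookup)

prism-imageSize≢2 : ∀ n → 3 ≤ n → n ≤ 5 → ∀ f → Distinguishing (prism n) f → imageSize (prism n) f ≢ 2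
prism-imageSize≢2 3 _ _ = allHaveTwins⇒imageSize≢2 (prism 3)
  (from-yes (dist≗prismDist? 3)) refl (from-yes (allHaveTwins? 3 2))
prism-imageSize≢2 4 _ _ = allHaveTwins⇒imageSize≢2 (prism 4)
  (from-yes (dist≗prismDist? 4)) refl (from-yes (allHaveTwins? 4 3))
prism-imageSize≢2 5 _ _ = allHaveTwins⇒imageSize≢2 (prism 5)
  (from-yes (dist≗prismDist? 5)) refl (from-yes (allHaveTwins? 5 3))
prism-imageSize≢2 (suc (suc (suc (suc (suc (suc _)))))) _ (s≤s (s≤s (s≤s (s≤s (s≤s ())))))
prism-imageSize≢2 1 (s≤s ()) _
prism-imageSize≢2 2 (s≤s (s≤s ())) _

proposition5 : (n : ℕ) → 3 ≤ n → n ≤ 5 → (k : ℕ) → IsIDI (prism n) k → k ≢ 2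
proposition5 n 3≤n n≤5 k ((f , distinguishing , size≡k) , _) k≡2 =
  prism-imageSize≢2 n 3≤n n≤5 f distinguishing (trans size≡k k≡2)
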